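{- Let $D$ be a ring with $\mathbb Z\subseteq D\subseteq \mathbb Q$ and let $d\ge 2$. In the Coefficient-Choosing Game with parameters $D$ and $d$, the player who makes the last play has a winning strategy.
   Context: The Coefficient-Choosing Game with parameters an integral domain $D$ and a degree $d\ge 2$: one of two players, Wanda or Nora, is designated Player I and the other Player II. Starting with Player I, the players alternately choose the coefficients $a_0,\dots,a_d\in D$ of a polynomial $f(x)=a_dx^d+\cdots+a_1x+a_0$; on each turn the player picks any not-yet-chosen index $i$ (the order is not predetermined) and a value $a_i\in D$, subject to the rule that $a_d\neq 0$ and $a_0\neq 0$. When all $d+1$ coefficients are chosen, Wanda wins if $f$ has a root in the field of fractions of $D$, and Nora wins otherwise. "A player wins" means that player has a strategy that wins no matter how the other plays. -}

module Defs where

open import Data.Nat using (ℕ; zero; suc)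
open import Data.Fin using (Fin; zero; suc; fromℕ)
open import Data.Fin.Properties using () renaming (_≟_ to _≟ᶠ_)
open import Data.Integer using (ℤ)
open import Data.Rational using (ℚ; 0ℚ; 1ℚ; _+_; _*_; -_; _/_)
open import Data.Maybe using (Maybe; just; nothing)
open import Data.Product using (Σ; ∃; _×_; _,_)
open import Data.Sum using (_⊎_)
open import Relation.Nullary using (¬_; yes; no)
open import Relation.Binary.PropositionalEquality using (_≡_; _≢_)
open import Function using (_∘_)

record SubringZQ : Set₁ where
  field
    D        : ℚ → Set
    D-0      : D 0ℚ
    D-1      : D 1ℚ
    D-+      : ∀ {x y} → D x → D y → D (x + y)
    D-neg    : ∀ {x} → D x → D (- x)
    D-*      : ∀ {x y} → D x → D y → D (x * y)
    D-⊇ℤ     : ∀ (z : ℤ) → D (z / 1)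

data Player : Set where
  Wanda Nora : Player

other : Player → Player
other Wanda = Nora
other Nora  = Wanda

-- the player making move number k (0-indexed) when `first` is Player I
moverOf : ℕ → Player → Player
moverOf zero    p = p
moverOf (suc k) p = moverOf k (other p)

-- evaluation of Σ_i a_i x^i (Horner), a_i the coefficient of x^i
eval : ∀ n → (Fin n → ℚ) → ℚ → ℚ
eval zero    a x = 0ℚ
eval (suc n) a x = a zero + x * eval n (a ∘ suc) x

-- f has a root in the field of fractions of D, realised inside ℚ as
-- the elements p/q with p, q ∈ D, q ≠ 0.
HasRootInFrac : SubringZQ → ∀ n → (Fin n → ℚ) → Set
HasRootInFrac R n a =
  Σ ℚ λ r → (Σ ℚ λ p → Σ ℚ λ q → D p × D q × q ≢ 0ℚ × r * q ≡ p)
           × eval n a r ≡ 0ℚ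
  where open SubringZQ R

WinnerIs : SubringZQ → ∀ n → (Fin n → ℚ) → Player → Set
WinnerIs R n a Wanda = HasRootInFrac R n a
WinnerIs R n a Nora  = ¬ HasRootInFrac R n a

-- positions: partially chosen coefficients a_0 … a_d
Position : ℕ → Set
Position d = Fin (suc d) → Maybe ℚ

emptyPos : ∀ d → Position d
emptyPos d _ = nothing

update : ∀ {d} → Position d → Fin (suc d) → ℚ → Position d
update c i a j with j ≟ᶠ i
... | yes _ = just a
... | no  _ = c j

LegalMove : SubringZQ → ∀ d → Position d → Fin (suc d) → ℚ → Set
LegalMove R d c i a =
  c i ≡ nothing × D a × ((i ≡ zero ⊎ i ≡ fromℕ d) → a ≢ 0ℚ)
  where open SubringZQ R

-- Wins R d p m c : player p has a winning strategy from position c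
-- when it is player m's turn to move.
data Wins (R : SubringZQ) (d : ℕ) (p : Player) : Player → Position d → Set where
  finished : ∀ {m c} (a : Fin (suc d) → ℚ) →
             (∀ i → c i ≡ just (a i)) → WinnerIs R (suc d) a p →
             Wins R d p m c
  ownMove  : ∀ {c} (i : Fin (suc d)) (a : ℚ) → LegalMove R d c i a →
             Wins R d p (other p) (update c i a) →
             Wins R d p p c
  oppMove  : ∀ {c} → (∃ λ i → c i ≡ nothing) →
             (∀ i a → LegalMove R d c i a →
                Wins R d p p (update c i a)) →
             Wins R d p (other p) c

module Submission where

-- Until the last move the
-- eventual last mover plays the harmless value 1; everything rests on
-- the last move, where one coefficient a_i is still free.
--   * Wanda forces a root in Frac D: the root 1 if 0 < i < d, an integer
--     root k if i = 0 and a reciprocal 1/k if i = d; a suitable small k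
--     exists because a nonzero polynomial has few roots.
--   * Nora clears denominators (f = M⁻¹·F with F integral) and uses the
--     rational root theorem for the binary form of F: a huge middle
--     coefficient if 0 < i < d, the constant term M·P for a large prime P
--     if i = 0 (a P-adic argument plus size bounds), and the reversed
--     polynomial if i = d.

open import Defs
open import Data.Nat as ℕ using (ℕ; zero; suc; _≤_; _<_; _≥_; z≤n; s≤s; _!)
import Data.Nat.Properties as ℕ
open import Data.Nat.Solver using () renaming (module +-*-Solver to ℕ-Solver)
open import Data.Nat.Divisibility
  using (_∣_; _∣?_; divides; ∣⇒≤; ∣-refl; ∣-trans; ∣m⇒∣m*n; ∣m+n∣m⇒∣n; m≤n⇒m!∣n!)
open import Data.Nat.Coprimality as Coprimality using (Coprime)
open import Data.Nat.Primality using (Prime; euclidsLemma; prime⇒nonTrivial; prime⇒irreducible)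
open import Data.Nat.Primality.Factorisation using (factorise; PrimeFactorisation)
open import Data.Nat.ListAction using (product)
open import Data.List using (List; []; _∷_)
open import Data.List.Relation.Unary.All using (All; _∷_)
open import Data.Integer as ℤ using (ℤ; +_; -[1+_]) renaming (∣_∣ to abs)
import Data.Integer.Properties as ℤ
open import Data.Integer.Solver using () renaming (module +-*-Solver to ℤ-Solver)
open import Data.Rational
  using (ℚ; mkℚ; 0ℚ; 1ℚ; _+_; _*_; -_; _-_; _/_; 1/_; ↥_; ↧_; ↧ₙ_; toℚᵘ; ≢-nonZero)
open import Data.Rational.Properties
  using (_≟_; ↥p/↧p≡p; ↥p≡0⇒p≡0; toℚᵘ-injective; toℚᵘ-homo-+; toℚᵘ-homo-*;
         +-identityˡ; *-identityˡ; *-identityʳ; *-zeroʳ; *-assoc; *-inverseˡ; *-inverseʳ)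
open import Data.Rational.Solver using (module +-*-Solver)
open import Data.Rational.Unnormalised as U using (mkℚᵘ; *≡*)
import Data.Rational.Unnormalised.Properties as UP
open import Data.Fin using (Fin; zero; suc; toℕ; fromℕ; inject₁; opposite)
import Data.Fin.Properties as Fin
open import Data.Vec.Functional using (tail) renaming (_∷_ to _◂_)
open import Data.Maybe using (Maybe; just; nothing; fromMaybe)
import Data.Maybe.Properties as Maybe
open import Data.Product using (Σ; _×_; _,_; proj₁; proj₂)
open import Data.Sum using (_⊎_; inj₁; inj₂)
open import Data.Empty using (⊥; ⊥-elim)
open import Relation.Nullary using (¬_; Dec; yes; no)
open import Relation.Nullary.Decidable using (¬?; decidable-stable)
open import Function using (_∘_)
open import Relation.Binary.PropositionalEquality

module RationalArithmetic where

  open +-*-Solver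

  *-cancel-nonzeroˡ : ∀ {x y} → x * y ≡ 0ℚ → x ≢ 0ℚ → y ≡ 0ℚ
  *-cancel-nonzeroˡ {x} {y} xy≡0 x≢0 = begin
      y                  ≡⟨ sym (*-identityˡ y) ⟩
      1ℚ * y             ≡⟨ cong (_* y) (sym (*-inverseˡ x)) ⟩
      (1/ x * x) * y     ≡⟨ *-assoc (1/ x) x y ⟩
      1/ x * (x * y)     ≡⟨ cong (1/ x *_) xy≡0 ⟩
      1/ x * 0ℚ          ≡⟨ *-zeroʳ (1/ x) ⟩
      0ℚ                 ∎
    where open ≡-Reasoning
          instance _ = ≢-nonZero x≢0

  *-nonzero : ∀ {x y} → x ≢ 0ℚ → y ≢ 0ℚ → x * y ≢ 0ℚ
  *-nonzero x≢0 y≢0 xy≡0 = y≢0 (*-cancel-nonzeroˡ xy≡0 x≢0)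

  neg-nonzero : ∀ {x} → x ≢ 0ℚ → - x ≢ 0ℚ
  neg-nonzero {x} x≢0 -x≡0 = x≢0 (trans (solve 1 (λ x → x := :- (:- x)) refl x) (cong -_ -x≡0))

  x-y≡0⇒x≡y : ∀ {x y} → x - y ≡ 0ℚ → x ≡ y
  x-y≡0⇒x≡y {x} {y} x-y≡0 = begin
     x            ≡⟨ solve 2 (λ x y → x := (x :- y) :+ y) refl x y ⟩
     (x - y) + y  ≡⟨ cong (_+ y) x-y≡0 ⟩
     0ℚ + y       ≡⟨ +-identityˡ y ⟩
     y            ∎
    where open ≡-Reasoning

  infixr 8 _^_
  _^_ : ℚ → ℕ → ℚ
  x ^ zero  = 1ℚ
  x ^ suc n = x * x ^ n

  ^-nonzero : ∀ {x} n → x ≢ 0ℚ → x ^ n ≢ 0ℚ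
  ^-nonzero zero    _   ()
  ^-nonzero (suc n) x≢0 = *-nonzero x≢0 (^-nonzero n x≢0)

  1^n≡1 : ∀ n → 1ℚ ^ n ≡ 1ℚ
  1^n≡1 zero    = refl
  1^n≡1 (suc n) = trans (cong (1ℚ *_) (1^n≡1 n)) (*-identityˡ 1ℚ)

  ^-distrib-* : ∀ x y n → x ^ n * y ^ n ≡ (x * y) ^ n
  ^-distrib-* x y zero    = *-identityˡ 1ℚ
  ^-distrib-* x y (suc n) =
    trans (solve 4 (λ x y a b → (x :* a) :* (y :* b) := (x :* y) :* (a :* b)) refl x y (x ^ n) (y ^ n))
          (cong ((x * y) *_) (^-distrib-* x y n))

-- Its ring laws are transported from the unnormalised rationals, where
-- they are identities between integer cross-multiplications.
module IntegerEmbedding where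

  open RationalArithmetic

  ι : ℤ → ℚ
  ι z = z / 1

  ι-normal : ∀ z → ι z ≡ mkℚ z 0 (Coprimality.sym (Coprimality.1-coprimeTo (abs z)))
  ι-normal z = ↥p/↧p≡p (mkℚ z 0 (Coprimality.sym (Coprimality.1-coprimeTo (abs z))))

  ↥ι : ∀ z → ↥ (ι z) ≡ z
  ↥ι z = cong ↥_ (ι-normal z)

  ι-injective : ∀ {x y} → ι x ≡ ι y → x ≡ y
  ι-injective {x} {y} ιx≡ιy = trans (sym (↥ι x)) (trans (cong ↥_ ιx≡ιy) (↥ι y))

  toℚᵘ-ι : ∀ z → toℚᵘ (ι z) ≡ mkℚᵘ z 0
  toℚᵘ-ι z = cong toℚᵘ (ι-normal z)

  ι-+ : ∀ x y → ι (x ℤ.+ y) ≡ ι x + ι y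
  ι-+ x y = toℚᵘ-injective (begin
      toℚᵘ (ι (x ℤ.+ y))                ≈⟨ UP.≃-reflexive (toℚᵘ-ι (x ℤ.+ y)) ⟩
      mkℚᵘ (x ℤ.+ y) 0                  ≈⟨ *≡* (solve 2 (λ a b → (a :+ b) :* con (+ 1) := (a :* con (+ 1) :+ b :* con (+ 1)) :* con (+ 1)) refl x y) ⟩
      mkℚᵘ x 0 U.+ mkℚᵘ y 0             ≈⟨ UP.≃-reflexive (sym (cong₂ U._+_ (toℚᵘ-ι x) (toℚᵘ-ι y))) ⟩
      toℚᵘ (ι x) U.+ toℚᵘ (ι y)         ≈⟨ UP.≃-sym (toℚᵘ-homo-+ (ι x) (ι y)) ⟩
      toℚᵘ (ι x + ι y)                  ∎)
    where open UP.≃-Reasoning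
          open ℤ-Solver

  ι-* : ∀ x y → ι (x ℤ.* y) ≡ ι x * ι y
  ι-* x y = toℚᵘ-injective (begin
      toℚᵘ (ι (x ℤ.* y))                ≈⟨ UP.≃-reflexive (toℚᵘ-ι (x ℤ.* y)) ⟩
      mkℚᵘ (x ℤ.* y) 0                  ≈⟨ *≡* (solve 2 (λ a b → (a :* b) :* con (+ 1) := (a :* b) :* con (+ 1)) refl x y) ⟩
      mkℚᵘ x 0 U.* mkℚᵘ y 0             ≈⟨ UP.≃-reflexive (sym (cong₂ U._*_ (toℚᵘ-ι x) (toℚᵘ-ι y))) ⟩
      toℚᵘ (ι x) U.* toℚᵘ (ι y)         ≈⟨ UP.≃-sym (toℚᵘ-homo-* (ι x) (ι y)) ⟩
      toℚᵘ (ι x * ι y)                  ∎)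
    where open UP.≃-Reasoning
          open ℤ-Solver

  ι-^ : ∀ q n → ι (q ℤ.^ n) ≡ ι q ^ n
  ι-^ q zero    = refl
  ι-^ q (suc n) = trans (ι-* q (q ℤ.^ n)) (cong (ι q *_) (ι-^ q n))

  ↧*≡↥ : ∀ r → ι (↧ r) * r ≡ ι (↥ r)
  ↧*≡↥ r@(mkℚ n _ _) = toℚᵘ-injective (begin
      toℚᵘ (ι (↧ r) * r)                ≈⟨ toℚᵘ-homo-* (ι (↧ r)) r ⟩
      toℚᵘ (ι (↧ r)) U.* toℚᵘ r         ≈⟨ UP.≃-reflexive (cong (U._* toℚᵘ r) (toℚᵘ-ι (↧ r))) ⟩
      mkℚᵘ (↧ r) 0 U.* toℚᵘ r           ≈⟨ *≡* (solve 2 (λ a b → (a :* b) :* con (+ 1) := b :* (con (+ 1) :* a)) refl (↧ r) n) ⟩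
      mkℚᵘ n 0                          ≈⟨ UP.≃-reflexive (sym (toℚᵘ-ι n)) ⟩
      toℚᵘ (ι n)                        ∎)
    where open UP.≃-Reasoning
          open ℤ-Solver

  ι-suc≢0 : ∀ k → ι (+ suc k) ≢ 0ℚ
  ι-suc≢0 k ιk≡0 with ι-injective {+ suc k} {+ 0} ιk≡0
  ... | ()

  ι-pos≢0 : ∀ {n} → 1 ℕ.≤ n → ι (+ n) ≢ 0ℚ
  ι-pos≢0 {suc k} _ = ι-suc≢0 k

  ι-suc-injective : ∀ i j → ι (+ suc i) ≡ ι (+ suc j) → i ≡ j
  ι-suc-injective i j ι≡ with ι-injective {+ suc i} {+ suc j} ι≡
  ... | refl = refl

  recip : ℕ → ℚ
  recip k = 1/_ (ι (+ suc k)) {{≢-nonZero (ι-suc≢0 k)}}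

  ι-suc*recip : ∀ k → ι (+ suc k) * recip k ≡ 1ℚ
  ι-suc*recip k = *-inverseʳ (ι (+ suc k)) {{≢-nonZero (ι-suc≢0 k)}}

  recip*ι-suc : ∀ k → recip k * ι (+ suc k) ≡ 1ℚ
  recip*ι-suc k = *-inverseˡ (ι (+ suc k)) {{≢-nonZero (ι-suc≢0 k)}}

  recip-injective : ∀ i j → recip i ≡ recip j → i ≡ j
  recip-injective i j recip≡ = ι-suc-injective i j (begin
      x                   ≡⟨ sym (*-identityʳ x) ⟩
      x * 1ℚ              ≡⟨ cong (x *_) (sym (recip*ι-suc j)) ⟩
      x * (recip j * y)   ≡⟨ cong (λ v → x * (v * y)) (sym recip≡) ⟩
      x * (recip i * y)   ≡⟨ sym (*-assoc x (recip i) y) ⟩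
      (x * recip i) * y   ≡⟨ cong (_* y) (ι-suc*recip i) ⟩
      1ℚ * y              ≡⟨ *-identityˡ y ⟩
      y                   ∎)
    where open ≡-Reasoning
          x = ι (+ suc i)
          y = ι (+ suc j)

module RationalPolynomials where

  open RationalArithmetic
  open IntegerEmbedding
  open +-*-Solver

  eval-cong : ∀ n {a b : Fin n → ℚ} → (∀ j → a j ≡ b j) → ∀ x → eval n a x ≡ eval n b x
  eval-cong zero    a≡b x = refl
  eval-cong (suc n) a≡b x = cong₂ (λ u v → u + x * v) (a≡b zero) (eval-cong n (a≡b ∘ suc) x)

  eval-at-0 : ∀ n (a : Fin (suc n) → ℚ) → eval (suc n) a 0ℚ ≡ a zero
  eval-at-0 n a = solve 2 (λ a₀ e → a₀ :+ con 0ℚ :* e := a₀) refl (a zero) (eval n (tail a) 0ℚ)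

  eval-scale : ∀ n k (a : Fin n → ℚ) x → eval n (λ j → k * a j) x ≡ k * eval n a x
  eval-scale zero    k a x = sym (*-zeroʳ k)
  eval-scale (suc n) k a x =
    trans (cong (λ v → k * a zero + x * v) (eval-scale n k (tail a) x))
          (solve 4 (λ k a₀ x e → k :* a₀ :+ x :* (k :* e) := k :* (a₀ :+ x :* e)) refl k (a zero) x (eval n (tail a) x))

  eval-differ-at : ∀ n (a b : Fin n → ℚ) i → (∀ j → j ≢ i → a j ≡ b j) → ∀ x →
                   eval n a x ≡ eval n b x + (a i - b i) * x ^ toℕ i
  eval-differ-at (suc n) a b zero a≡b x = begin
      a zero + x * eval n (tail a) x
        ≡⟨ cong (λ v → a zero + x * v) (eval-cong n (λ j → a≡b (suc j) (λ ())) x) ⟩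
      a zero + x * eval n (tail b) x
        ≡⟨ solve 4 (λ a₀ b₀ x e → a₀ :+ x :* e := (b₀ :+ x :* e) :+ (a₀ :- b₀) :* con 1ℚ) refl (a zero) (b zero) x (eval n (tail b) x) ⟩
      (b zero + x * eval n (tail b) x) + (a zero - b zero) * 1ℚ ∎
    where open ≡-Reasoning
  eval-differ-at (suc n) a b (suc i) a≡b x = begin
      a zero + x * eval n (tail a) x
        ≡⟨ cong₂ (λ u v → u + x * v) (a≡b zero (λ ()))
                 (eval-differ-at n (tail a) (tail b) i (λ j j≢i → a≡b (suc j) (j≢i ∘ Fin.suc-injective)) x) ⟩
      b zero + x * (eval n (tail b) x + δ * x ^ toℕ i)
        ≡⟨ solve 5 (λ b₀ x e δ p → b₀ :+ x :* (e :+ δ :* p) := (b₀ :+ x :* e) :+ δ :* (x :* p)) refl (b zero) x (eval n (tail b) x) δ (x ^ toℕ i) ⟩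
      (b zero + x * eval n (tail b) x) + δ * (x * x ^ toℕ i) ∎
    where open ≡-Reasoning
          δ = a (suc i) - b (suc i)

  -- Synthetic division by (x - r): the quotient's coefficients.
  quotient : ∀ n → (Fin (suc n) → ℚ) → ℚ → Fin n → ℚ
  quotient (suc n) a r zero    = eval (suc n) (tail a) r
  quotient (suc n) a r (suc j) = quotient n (tail a) r j

  factor-theorem : ∀ n a r x → eval (suc n) a x ≡ eval (suc n) a r + (x - r) * eval n (quotient n a r) x
  factor-theorem zero a r x =
    solve 3 (λ a₀ x r → a₀ :+ x :* con 0ℚ := (a₀ :+ r :* con 0ℚ) :+ (x :- r) :* con 0ℚ) refl (a zero) x r
  factor-theorem (suc n) a r x = begin
      a zero + x * E x
        ≡⟨ cong (λ v → a zero + x * v) (factor-theorem n (tail a) r x) ⟩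
      a zero + x * (E r + (x - r) * Q x)
        ≡⟨ solve 5 (λ a₀ x r e q → a₀ :+ x :* (e :+ (x :- r) :* q) := (a₀ :+ r :* e) :+ (x :- r) :* (e :+ x :* q)) refl (a zero) x r (E r) (Q x) ⟩
      (a zero + r * E r) + (x - r) * (E r + x * Q x) ∎
    where open ≡-Reasoning
          E = eval (suc n) (tail a)
          Q = eval n (quotient n (tail a) r)

  vanishing-at-distinct-points :
    ∀ n (a : Fin n → ℚ) (pt : ℕ → ℚ) → (∀ i j → pt i ≡ pt j → i ≡ j) →
    (∀ k → k ℕ.< n → eval n a (pt k) ≡ 0ℚ) → ∀ x → eval n a x ≡ 0ℚ
  vanishing-at-distinct-points zero    a pt pt-inj roots x = refl
  vanishing-at-distinct-points (suc m) a pt pt-inj roots x = begin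
      eval (suc m) a x                         ≡⟨ factor-theorem m a (pt 0) x ⟩
      eval (suc m) a (pt 0) + (x - pt 0) * Q x ≡⟨ cong₂ (λ u v → u + (x - pt 0) * v) (roots 0 (ℕ.s≤s ℕ.z≤n)) Q≡0 ⟩
      0ℚ + (x - pt 0) * 0ℚ                     ≡⟨ solve 1 (λ y → con 0ℚ :+ y :* con 0ℚ := con 0ℚ) refl (x - pt 0) ⟩
      0ℚ                                       ∎
    where
    open ≡-Reasoning
    q = quotient m a (pt 0)
    Q = eval m q
    q-roots : ∀ k → k ℕ.< m → Q (pt (suc k)) ≡ 0ℚ
    q-roots k k<m = *-cancel-nonzeroˡ (begin
        (pt (suc k) - pt 0) * Q (pt (suc k))                           ≡⟨ sym (+-identityˡ _) ⟩
        0ℚ + (pt (suc k) - pt 0) * Q (pt (suc k))                      ≡⟨ cong (_+ (pt (suc k) - pt 0) * Q (pt (suc k))) (sym (roots 0 (ℕ.s≤s ℕ.z≤n))) ⟩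
        eval (suc m) a (pt 0) + (pt (suc k) - pt 0) * Q (pt (suc k))   ≡⟨ sym (factor-theorem m a (pt 0) (pt (suc k))) ⟩
        eval (suc m) a (pt (suc k))                                    ≡⟨ roots (suc k) (ℕ.s≤s k<m) ⟩
        0ℚ                                                             ∎)
      (λ d≡0 → ℕ.1+n≢0 (pt-inj (suc k) 0 (x-y≡0⇒x≡y d≡0)))
    Q≡0 : Q x ≡ 0ℚ
    Q≡0 = vanishing-at-distinct-points m q (pt ∘ suc) (λ i j e → ℕ.suc-injective (pt-inj (suc i) (suc j) e)) q-roots x

  nonzero-at-some-point : ∀ n (a : Fin n → ℚ) (pt : ℕ → ℚ) → (∀ i j → pt i ≡ pt j → i ≡ j) →
    ¬ (∀ x → eval n a x ≡ 0ℚ) → Σ ℕ λ k → eval n a (pt k) ≢ 0ℚ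
  nonzero-at-some-point n a pt pt-inj a≢0 with ℕ.anyUpTo? (λ k → ¬? (eval n a (pt k) ≟ 0ℚ)) n
  ... | yes (k , _ , ak≢0) = k , ak≢0
  ... | no  no-witness    = ⊥-elim (a≢0 (vanishing-at-distinct-points n a pt pt-inj all-roots))
    where
    all-roots : ∀ k → k ℕ.< n → eval n a (pt k) ≡ 0ℚ
    all-roots k k<n = decidable-stable (eval n a (pt k) ≟ 0ℚ) (λ ak≢0 → no-witness (k , k<n , ak≢0))

  -- The zero function has only zero coefficients (tested at 0, 1, 2, …).
  zero-function⇒zero-coefficients : ∀ n (a : Fin n → ℚ) → (∀ x → eval n a x ≡ 0ℚ) → ∀ j → a j ≡ 0ℚ
  zero-function⇒zero-coefficients (suc n) a a≡0 zero    = trans (sym (eval-at-0 n a)) (a≡0 0ℚ)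
  zero-function⇒zero-coefficients (suc n) a a≡0 (suc j) =
    zero-function⇒zero-coefficients n (tail a)
      (vanishing-at-distinct-points n (tail a) pt ι-suc-injective tail-roots) j
    where
    pt : ℕ → ℚ
    pt k = ι (+ suc k)
    tail-roots : ∀ k → k ℕ.< n → eval n (tail a) (pt k) ≡ 0ℚ
    tail-roots k _ = *-cancel-nonzeroˡ (begin
        pt k * eval n (tail a) (pt k)          ≡⟨ sym (+-identityˡ _) ⟩
        0ℚ + pt k * eval n (tail a) (pt k)     ≡⟨ cong (_+ pt k * eval n (tail a) (pt k)) (sym (trans (sym (eval-at-0 n a)) (a≡0 0ℚ))) ⟩
        eval (suc n) a (pt k)                   ≡⟨ a≡0 (pt k) ⟩
        0ℚ                                      ∎) (ι-suc≢0 k)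
      where open ≡-Reasoning

  formℚ : ∀ n → (Fin n → ℚ) → ℚ → ℚ → ℚ
  formℚ zero    c p q = 0ℚ
  formℚ (suc n) c p q = c zero * q ^ n + p * formℚ n (tail c) p q

  formℚ-cong : ∀ n {a b : Fin n → ℚ} → (∀ j → a j ≡ b j) → ∀ p q → formℚ n a p q ≡ formℚ n b p q
  formℚ-cong zero    a≡b p q = refl
  formℚ-cong (suc n) a≡b p q = cong₂ (λ u v → u * q ^ n + p * v) (a≡b zero) (formℚ-cong n (a≡b ∘ suc) p q)

  formℚ-eval : ∀ n c p q r → q * r ≡ p → q ^ n * eval (suc n) c r ≡ formℚ (suc n) c p q
  formℚ-eval zero c p q r qr≡p =
    solve 3 (λ c r p → con 1ℚ :* (c :+ r :* con 0ℚ) := c :* con 1ℚ :+ p :* con 0ℚ) refl (c zero) r p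
  formℚ-eval (suc m) c p q r qr≡p = begin
      (q * q ^ m) * (c zero + r * E)               ≡⟨ solve 5 (λ q w c r E → (q :* w) :* (c :+ r :* E) := c :* (q :* w) :+ (q :* r) :* (w :* E))
                                                             refl q (q ^ m) (c zero) r E ⟩
      c zero * (q * q ^ m) + (q * r) * (q ^ m * E) ≡⟨ cong₂ (λ u v → c zero * (q * q ^ m) + u * v) qr≡p (formℚ-eval m (tail c) p q r qr≡p) ⟩
      c zero * (q * q ^ m) + p * formℚ (suc m) (tail c) p q ∎
    where open ≡-Reasoning
          E = eval (suc m) (tail c) r

-- For coefficients c₀ … c_{n-1} the form
--   form n c p q = Σ_j c_j p^j q^(n-1-j)
-- is q^(n-1) times the polynomial Σ c_j x^j evaluated at x = p/q, so
-- rational roots p/q correspond to integer zeros of the form.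
module IntegerForms where

  form : ∀ n → (Fin n → ℤ) → ℤ → ℤ → ℤ
  form zero    c p q = + 0
  form (suc n) c p q = c zero ℤ.* q ℤ.^ n ℤ.+ p ℤ.* form n (tail c) p q

  form-cong : ∀ n {a b : Fin n → ℤ} → (∀ j → a j ≡ b j) → ∀ p q → form n a p q ≡ form n b p q
  form-cong zero    a≡b p q = refl
  form-cong (suc n) a≡b p q = cong₂ (λ u v → u ℤ.* q ℤ.^ n ℤ.+ p ℤ.* v) (a≡b zero) (form-cong n (a≡b ∘ suc) p q)

  form-+ : ∀ n (a b : Fin n → ℤ) p q → form n (λ j → a j ℤ.+ b j) p q ≡ form n a p q ℤ.+ form n b p q
  form-+ zero    a b p q = refl
  form-+ (suc n) a b p q = begin
      (a zero ℤ.+ b zero) ℤ.* q ℤ.^ n ℤ.+ p ℤ.* form n (λ j → a (suc j) ℤ.+ b (suc j)) p q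
        ≡⟨ cong (λ v → (a zero ℤ.+ b zero) ℤ.* q ℤ.^ n ℤ.+ p ℤ.* v) (form-+ n (tail a) (tail b) p q) ⟩
      (a zero ℤ.+ b zero) ℤ.* q ℤ.^ n ℤ.+ p ℤ.* (form n (tail a) p q ℤ.+ form n (tail b) p q)
        ≡⟨ solve 6 (λ a b Q p x y → (a :+ b) :* Q :+ p :* (x :+ y) := (a :* Q :+ p :* x) :+ (b :* Q :+ p :* y)) refl
                   (a zero) (b zero) (q ℤ.^ n) p (form n (tail a) p q) (form n (tail b) p q) ⟩
      form (suc n) a p q ℤ.+ form (suc n) b p q ∎
    where open ≡-Reasoning
          open ℤ-Solver

  form-zero : ∀ n p q → form n (λ _ → + 0) p q ≡ + 0
  form-zero zero    p q = refl
  form-zero (suc n) p q = trans (cong (λ v → + 0 ℤ.* q ℤ.^ n ℤ.+ p ℤ.* v) (form-zero n p q))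
     (solve 2 (λ Q p → con (+ 0) :* Q :+ p :* con (+ 0) := con (+ 0)) refl (q ℤ.^ n) p)
    where open ℤ-Solver

  abs-^ : ∀ q n → abs (q ℤ.^ n) ≡ abs q ℕ.^ n
  abs-^ q zero    = refl
  abs-^ q (suc n) = trans (ℤ.abs-* q (q ℤ.^ n)) (cong (abs q ℕ.*_) (abs-^ q n))

  abs-*-^ : ∀ c q n → abs (c ℤ.* q ℤ.^ n) ≡ abs c ℕ.* abs q ℕ.^ n
  abs-*-^ c q n = trans (ℤ.abs-* c (q ℤ.^ n)) (cong (abs c ℕ.*_) (abs-^ q n))

  nonzero⇒1≤abs : ∀ {p} → p ≢ + 0 → 1 ≤ abs p
  nonzero⇒1≤abs {+ zero}   p≢0 = ⊥-elim (p≢0 refl)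
  nonzero⇒1≤abs {+ suc n}  _   = s≤s z≤n
  nonzero⇒1≤abs { -[1+ n ]} _  = s≤s z≤n

  1≤^ : ∀ a n → 1 ≤ a → 1 ≤ a ℕ.^ n
  1≤^ a zero    _   = s≤s z≤n
  1≤^ a (suc n) 1≤a = ℕ.*-mono-≤ 1≤a (1≤^ a n 1≤a)

  ≤*pos : ∀ a U → 1 ≤ U → a ≤ a ℕ.* U
  ≤*pos a U 1≤U = ℕ.≤-trans (ℕ.≤-reflexive (sym (ℕ.*-identityʳ a))) (ℕ.*-monoʳ-≤ a 1≤U)

  x+y≡0⇒x≡-y : ∀ {x y : ℤ} → x ℤ.+ y ≡ + 0 → x ≡ ℤ.- y
  x+y≡0⇒x≡-y {x} {y} x+y≡0 =
    trans (solve 2 (λ x y → x := (x :+ y) :+ :- y) refl x y) (trans (cong (ℤ._+ ℤ.- y) x+y≡0) (ℤ.+-identityˡ (ℤ.- y)))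
    where open ℤ-Solver

  zero-of-form : ∀ n (c : Fin (suc n) → ℤ) p q → form (suc n) c p q ≡ + 0 →
                 abs (c zero) ℕ.* abs q ℕ.^ n ≡ abs p ℕ.* abs (form n (tail c) p q)
  zero-of-form n c p q form≡0 = begin
      abs (c zero) ℕ.* abs q ℕ.^ n          ≡⟨ sym (abs-*-^ (c zero) q n) ⟩
      abs (c zero ℤ.* q ℤ.^ n)              ≡⟨ cong abs (x+y≡0⇒x≡-y {c zero ℤ.* q ℤ.^ n} {p ℤ.* form n (tail c) p q} form≡0) ⟩
      abs (ℤ.- (p ℤ.* form n (tail c) p q)) ≡⟨ ℤ.∣-i∣≡∣i∣ (p ℤ.* form n (tail c) p q) ⟩
      abs (p ℤ.* form n (tail c) p q)       ≡⟨ ℤ.abs-* p (form n (tail c) p q) ⟩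
      abs p ℕ.* abs (form n (tail c) p q)   ∎
    where open ≡-Reasoning

  coefficient-sum : ∀ n → (Fin n → ℤ) → ℕ
  coefficient-sum zero    c = 0
  coefficient-sum (suc n) c = abs (c zero) ℕ.+ coefficient-sum n (tail c)

  coefficient≤sum : ∀ n c j → abs (c j) ≤ coefficient-sum n c
  coefficient≤sum (suc n) c zero    = ℕ.m≤m+n _ _
  coefficient≤sum (suc n) c (suc j) = ℕ.≤-trans (coefficient≤sum n (tail c) j) (ℕ.m≤n+m _ _)

  form-bound : ∀ n c p q U → abs p ≤ U → abs q ≤ U →
               abs (form n c p q) ℕ.* U ≤ coefficient-sum n c ℕ.* U ℕ.^ n
  form-bound zero    c p q U p≤U q≤U = z≤n
  form-bound (suc n) c p q U p≤U q≤U = begin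
      abs (c zero ℤ.* q ℤ.^ n ℤ.+ p ℤ.* H) ℕ.* U
        ≤⟨ ℕ.*-monoˡ-≤ U (ℤ.∣i+j∣≤∣i∣+∣j∣ (c zero ℤ.* q ℤ.^ n) (p ℤ.* H)) ⟩
      (abs (c zero ℤ.* q ℤ.^ n) ℕ.+ abs (p ℤ.* H)) ℕ.* U
        ≡⟨ cong₂ (λ a b → (a ℕ.+ b) ℕ.* U) (abs-*-^ (c zero) q n) (ℤ.abs-* p H) ⟩
      (c₀ ℕ.* abs q ℕ.^ n ℕ.+ abs p ℕ.* abs H) ℕ.* U
        ≡⟨ solve 5 (λ c Q p h U → (c :* Q :+ p :* h) :* U := c :* Q :* U :+ p :* (h :* U)) refl c₀ (abs q ℕ.^ n) (abs p) (abs H) U ⟩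
      c₀ ℕ.* abs q ℕ.^ n ℕ.* U ℕ.+ abs p ℕ.* (abs H ℕ.* U)
        ≤⟨ ℕ.+-mono-≤ (ℕ.*-monoˡ-≤ U (ℕ.*-monoʳ-≤ c₀ (ℕ.^-monoˡ-≤ n q≤U))) (ℕ.*-mono-≤ p≤U (form-bound n (tail c) p q U p≤U q≤U)) ⟩
      c₀ ℕ.* U ℕ.^ n ℕ.* U ℕ.+ U ℕ.* (S ℕ.* U ℕ.^ n)
        ≡⟨ solve 4 (λ c s Un U → c :* Un :* U :+ U :* (s :* Un) := (c :+ s) :* (U :* Un)) refl c₀ S (U ℕ.^ n) U ⟩
      (c₀ ℕ.+ S) ℕ.* (U ℕ.* U ℕ.^ n) ∎
    where open ℕ.≤-Reasoning
          open ℕ-Solver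
          H = form n (tail c) p q
          c₀ = abs (c zero)
          S = coefficient-sum n (tail c)

  single : ∀ {n} → Fin n → ℤ → Fin n → ℤ
  single zero    x zero    = x
  single zero    x (suc j) = + 0
  single (suc i) x zero    = + 0
  single (suc i) x (suc j) = single i x j

  single-at : ∀ {n} (i : Fin n) x → single i x i ≡ x
  single-at zero    x = refl
  single-at (suc i) x = single-at i x

  single-off : ∀ {n} (i j : Fin n) x → j ≢ i → single i x j ≡ + 0
  single-off zero    zero    x j≢i = ⊥-elim (j≢i refl)
  single-off zero    (suc j) x j≢i = refl
  single-off (suc i) zero    x j≢i = refl
  single-off (suc i) (suc j) x j≢i = single-off i j x (j≢i ∘ cong suc)

  single-lower-bound : ∀ n i x p q → p ≢ + 0 → q ≢ + 0 → abs x ≤ abs (form n (single i x) p q)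
  single-lower-bound (suc n) zero x p q p≢0 q≢0 = begin
      abs x                                 ≡⟨ sym (ℕ.*-identityʳ (abs x)) ⟩
      abs x ℕ.* 1                           ≤⟨ ℕ.*-monoʳ-≤ (abs x) (1≤^ (abs q) n (nonzero⇒1≤abs q≢0)) ⟩
      abs x ℕ.* abs q ℕ.^ n                 ≡⟨ sym (abs-*-^ x q n) ⟩
      abs (x ℤ.* q ℤ.^ n)                   ≡⟨ cong abs (sym (trans (cong (λ v → x ℤ.* q ℤ.^ n ℤ.+ p ℤ.* v) (form-zero n p q))
                                                 (solve 3 (λ x Q p → x :* Q :+ p :* con (+ 0) := x :* Q) refl x (q ℤ.^ n) p))) ⟩
      abs (form (suc n) (single zero x) p q) ∎
    where open ℕ.≤-Reasoning
          open ℤ-Solver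
  single-lower-bound (suc n) (suc i) x p q p≢0 q≢0 = begin
      abs x                                 ≤⟨ single-lower-bound n i x p q p≢0 q≢0 ⟩
      abs H                                 ≡⟨ sym (ℕ.*-identityˡ _) ⟩
      1 ℕ.* abs H                           ≤⟨ ℕ.*-monoˡ-≤ _ (nonzero⇒1≤abs p≢0) ⟩
      abs p ℕ.* abs H                       ≡⟨ sym (ℤ.abs-* p _) ⟩
      abs (p ℤ.* H)                         ≡⟨ cong abs (sym (solve 2 (λ Q y → con (+ 0) :* Q :+ y := y) refl (q ℤ.^ n) (p ℤ.* H))) ⟩
      abs (form (suc n) (single (suc i) x) p q) ∎
    where open ℕ.≤-Reasoning
          open ℤ-Solver
          H = form n (single i x) p q

  form-peel-top : ∀ m (c : Fin (suc (suc m)) → ℤ) p q →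
    form (suc (suc m)) c p q ≡ c (fromℕ (suc m)) ℤ.* p ℤ.^ suc m ℤ.+ q ℤ.* form (suc m) (c ∘ inject₁) p q
  form-peel-top zero c p q =
    solve 4 (λ a b p q → a :* (q :* con (+ 1)) :+ p :* (b :* con (+ 1) :+ p :* con (+ 0))
                     := b :* (p :* con (+ 1)) :+ q :* (a :* con (+ 1) :+ p :* con (+ 0))) refl (c zero) (c (suc zero)) p q
    where open ℤ-Solver
  form-peel-top (suc m) c p q = begin
      c zero ℤ.* q ℤ.^ suc (suc m) ℤ.+ p ℤ.* form (suc (suc m)) (tail c) p q
        ≡⟨ cong (λ v → c zero ℤ.* q ℤ.^ suc (suc m) ℤ.+ p ℤ.* v) (form-peel-top m (tail c) p q) ⟩
      c zero ℤ.* (q ℤ.* q ℤ.^ suc m) ℤ.+ p ℤ.* (c (fromℕ (suc (suc m))) ℤ.* p ℤ.^ suc m ℤ.+ q ℤ.* X)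
        ≡⟨ solve 7 (λ a Q t P Pm q X → a :* (q :* Q) :+ P :* (t :* Pm :+ q :* X) := t :* (P :* Pm) :+ q :* (a :* Q :+ P :* X)) refl
                   (c zero) (q ℤ.^ suc m) (c (fromℕ (suc (suc m)))) p (p ℤ.^ suc m) q X ⟩
      c (fromℕ (suc (suc m))) ℤ.* p ℤ.^ suc (suc m) ℤ.+ q ℤ.* form (suc (suc m)) (c ∘ inject₁) p q ∎
    where open ≡-Reasoning
          open ℤ-Solver
          X = form (suc m) (tail c ∘ inject₁) p q

  form-reverse : ∀ n (c : Fin (suc n) → ℤ) p q → form (suc n) c p q ≡ form (suc n) (c ∘ opposite) q p
  form-reverse zero c p q =
    solve 3 (λ a p q → a :* con (+ 1) :+ p :* con (+ 0) := a :* con (+ 1) :+ q :* con (+ 0)) refl (c zero) p q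
    where open ℤ-Solver
  form-reverse (suc m) c p q = begin
      form (suc (suc m)) c p q
        ≡⟨ form-peel-top m c p q ⟩
      c (fromℕ (suc m)) ℤ.* p ℤ.^ suc m ℤ.+ q ℤ.* form (suc m) (c ∘ inject₁) p q
        ≡⟨ cong (λ v → c (fromℕ (suc m)) ℤ.* p ℤ.^ suc m ℤ.+ q ℤ.* v) (form-reverse m (c ∘ inject₁) p q) ⟩
      form (suc (suc m)) (c ∘ opposite) q p ∎
    where open ≡-Reasoning

  coprime-divides-power : ∀ a b m x → Coprime a b → a ∣ b ℕ.^ m ℕ.* x → a ∣ x
  coprime-divides-power a b zero    x a⊥b a∣ = subst (a ∣_) (ℕ.*-identityˡ x) a∣
  coprime-divides-power a b (suc m) x a⊥b a∣ =
    coprime-divides-power a b m x a⊥b (Coprimality.coprime-divisor a⊥b (subst (a ∣_) (ℕ.*-assoc b (b ℕ.^ m) x) a∣))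

  root-numerator∣constant : ∀ m c p q → form (suc m) c p q ≡ + 0 → Coprime (abs p) (abs q) → abs p ∣ abs (c zero)
  root-numerator∣constant m c p q form≡0 p⊥q =
    coprime-divides-power (abs p) (abs q) m (abs (c zero)) p⊥q (divides (abs (form m (tail c) p q)) (begin
      abs q ℕ.^ m ℕ.* abs (c zero)          ≡⟨ ℕ.*-comm _ (abs (c zero)) ⟩
      abs (c zero) ℕ.* abs q ℕ.^ m          ≡⟨ zero-of-form m c p q form≡0 ⟩
      abs p ℕ.* abs (form m (tail c) p q)   ≡⟨ ℕ.*-comm (abs p) _ ⟩
      abs (form m (tail c) p q) ℕ.* abs p   ∎))
    where open ≡-Reasoning

  root-denominator∣leading : ∀ m c p q → form (suc m) c p q ≡ + 0 → Coprime (abs p) (abs q) → abs q ∣ abs (c (fromℕ m))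
  root-denominator∣leading m c p q form≡0 p⊥q =
    root-numerator∣constant m (c ∘ opposite) q p (trans (sym (form-reverse m c p q)) form≡0) (Coprimality.sym p⊥q)

module Primes where

  1<prime : ∀ {P} → Prime P → 1 < P
  1<prime {P} P-prime = ℕ.nonTrivial⇒n>1 P {{prime⇒nonTrivial P-prime}}

  prime∤1 : ∀ {P} → Prime P → ¬ (P ∣ 1)
  prime∤1 P-prime P∣1 = ℕ.<⇒≱ (1<prime P-prime) (∣⇒≤ P∣1)

  -- Any prime factor of n! + 1 exceeds n.
  prime-above : ∀ n → Σ ℕ λ P → Prime P × n < P
  prime-above n = first-factor-above (PrimeFactorisation.factors F)
    (PrimeFactorisation.isFactorisation F) (PrimeFactorisation.factorsPrime F)
    where
    F = factorise (n ! ℕ.+ 1) {{ℕ.>-nonZero (ℕ.m≤n+m 1 (n !))}}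
    first-factor-above : (fs : List ℕ) → n ! ℕ.+ 1 ≡ product fs → All Prime fs → Σ ℕ λ P → Prime P × n < P
    first-factor-above [] n!+1≡1 _ =
      ⊥-elim (ℕ.≢-nonZero⁻¹ (n !) {{n ℕ.!≢0}} (cong ℕ.pred (trans (ℕ.+-comm 1 (n !)) n!+1≡1)))
    first-factor-above (P ∷ fs) n!+1≡Pfs (P-prime ∷ _) with n ℕ.<? P
    ... | yes n<P = P , P-prime , n<P
    ... | no  n≮P = ⊥-elim (prime∤1 P-prime (∣m+n∣m⇒∣n P∣n!+1 (∣-trans (n∣n! (ℕ.<⇒≤ (1<prime P-prime))) (m≤n⇒m!∣n! (ℕ.≮⇒≥ n≮P)))))
      where
      n∣n! : ∀ {m} → 0 < m → m ∣ m !
      n∣n! {suc k} _ = ∣m⇒∣m*n (k !) ∣-refl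
      P∣n!+1 : P ∣ n ! ℕ.+ 1
      P∣n!+1 = subst (P ∣_) (sym n!+1≡Pfs) (∣m⇒∣m*n (product fs) ∣-refl)

  prime∣^⇒prime∣ : ∀ P a m → Prime P → P ∣ a ℕ.^ m → P ∣ a
  prime∣^⇒prime∣ P a zero    P-prime P∣1 = ⊥-elim (prime∤1 P-prime P∣1)
  prime∣^⇒prime∣ P a (suc m) P-prime P∣aaᵐ with euclidsLemma a (a ℕ.^ m) P-prime P∣aaᵐ
  ... | inj₁ P∣a  = P∣a
  ... | inj₂ P∣aᵐ = prime∣^⇒prime∣ P a m P-prime P∣aᵐ

  ∣-below⇒zero : ∀ P x → P ∣ x → x < P → x ≡ 0
  ∣-below⇒zero P zero    _   _   = refl
  ∣-below⇒zero P (suc x) P∣x x<P = ⊥-elim (ℕ.<⇒≱ x<P (∣⇒≤ P∣x))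

module NonvanishingForms where

  open IntegerForms
  open Primes

  -- If P | p, P ∤ q and all coefficients are smaller than P with the
  -- leading one nonzero, the form cannot vanish: reducing mod P kills the
  -- constant coefficient, then divide by p and repeat.
  P-adic-nonvanishing : ∀ m (c : Fin (suc m) → ℤ) P p q → Prime P → c (fromℕ m) ≢ + 0 →
    (∀ j → abs (c j) < P) → ¬ (P ∣ abs q) → P ∣ abs p → p ≢ + 0 → form (suc m) c p q ≢ + 0
  P-adic-nonvanishing zero c P p q P-prime top≢0 small P∤q P∣p p≢0 form≡0 =
    top≢0 (trans (solve 2 (λ a p → a := a :* con (+ 1) :+ p :* con (+ 0)) refl (c zero) p) form≡0)
    where open ℤ-Solver
  P-adic-nonvanishing (suc m) c P p q P-prime top≢0 small P∤q P∣p p≢0 form≡0 =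
    P-adic-nonvanishing m (tail c) P p q P-prime top≢0 (small ∘ suc) P∤q P∣p p≢0 T≡0
    where
    T = form (suc m) (tail c) p q
    P∣c₀qᵐ : P ∣ abs (c zero) ℕ.* abs q ℕ.^ suc m
    P∣c₀qᵐ = subst (P ∣_) (sym (zero-of-form (suc m) c p q form≡0)) (∣m⇒∣m*n (abs T) P∣p)
    c₀≡0 : c zero ≡ + 0
    c₀≡0 with euclidsLemma (abs (c zero)) (abs q ℕ.^ suc m) P-prime P∣c₀qᵐ
    ... | inj₁ P∣c₀  = ℤ.∣i∣≡0⇒i≡0 (∣-below⇒zero P (abs (c zero)) P∣c₀ (small zero))
    ... | inj₂ P∣qᵐ  = ⊥-elim (P∤q (prime∣^⇒prime∣ P (abs q) (suc m) P-prime P∣qᵐ))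
    pT≡0 : p ℤ.* T ≡ + 0
    pT≡0 = trans (sym (solve 2 (λ Q y → con (+ 0) :* Q :+ y := y) refl (q ℤ.^ suc m) (p ℤ.* T)))
                 (trans (cong (λ v → v ℤ.* q ℤ.^ suc m ℤ.+ p ℤ.* T) (sym c₀≡0)) form≡0)
      where open ℤ-Solver
    T≡0 : T ≡ + 0
    T≡0 with ℤ.i*j≡0⇒i≡0∨j≡0 p pT≡0
    ... | inj₁ p≡0 = ⊥-elim (p≢0 p≡0)
    ... | inj₂ T≡0 = T≡0

  -- Adding x at a middle position i: the rational root theorem bounds
  -- |p|, |q| by U = |G₀| + |G_d|, so the form of G is at most S·U^(d+1)
  -- in size, too small to cancel the new monomial of size ≥ |x|.
  large-middle-nonvanishing : ∀ d (G : Fin (suc d) → ℤ) i x p q →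
    G zero ≢ + 0 → G (fromℕ d) ≢ + 0 → zero ≢ i → fromℕ d ≢ i →
    coefficient-sum (suc d) G ℕ.* (abs (G zero) ℕ.+ abs (G (fromℕ d))) ℕ.^ suc d < abs x →
    p ≢ + 0 → q ≢ + 0 → Coprime (abs p) (abs q) →
    form (suc d) (λ j → G j ℤ.+ single i x j) p q ≢ + 0
  large-middle-nonvanishing d G i x p q G₀≢0 G_d≢0 i≢0 i≢d x-large p≢0 q≢0 p⊥q form≡0 =
    ℕ.<⇒≱ (ℕ.≤-<-trans G-small x-large)
          (ℕ.≤-trans (single-lower-bound (suc d) i x p q p≢0 q≢0) (ℕ.≤-reflexive single≡G))
    where
    F = λ j → G j ℤ.+ single i x j
    U = abs (G zero) ℕ.+ abs (G (fromℕ d))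
    unchanged : ∀ j → j ≢ i → F j ≡ G j
    unchanged j j≢i = trans (cong (λ v → G j ℤ.+ v) (single-off i j x j≢i)) (ℤ.+-identityʳ (G j))
    p≤U : abs p ≤ U
    p≤U = ℕ.≤-trans (∣⇒≤ {{ℕ.>-nonZero (nonzero⇒1≤abs G₀≢0)}}
                      (subst (λ v → abs p ∣ abs v) (unchanged zero i≢0) (root-numerator∣constant d F p q form≡0 p⊥q)))
                    (ℕ.m≤m+n _ _)
    q≤U : abs q ≤ U
    q≤U = ℕ.≤-trans (∣⇒≤ {{ℕ.>-nonZero (nonzero⇒1≤abs G_d≢0)}}
                      (subst (λ v → abs q ∣ abs v) (unchanged (fromℕ d) i≢d) (root-denominator∣leading d F p q form≡0 p⊥q)))
                    (ℕ.m≤n+m _ _)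
    G-form = form (suc d) G p q
    x-form = form (suc d) (single i x) p q
    single≡G : abs x-form ≡ abs G-form
    single≡G = trans (sym (ℤ.∣-i∣≡∣i∣ x-form))
      (cong abs (sym (x+y≡0⇒x≡-y {G-form} {x-form} (trans (sym (form-+ (suc d) G (single i x) p q)) form≡0))))
    G-small : abs G-form ≤ coefficient-sum (suc d) G ℕ.* U ℕ.^ suc d
    G-small = ℕ.≤-trans (≤*pos (abs G-form) U (ℕ.≤-trans (nonzero⇒1≤abs G₀≢0) (ℕ.m≤m+n _ _)))
                        (form-bound (suc d) G p q U p≤U q≤U)

  constant-dominated : ∀ n c (t : Fin n → ℤ) p q U → abs p ≤ U → abs q ≤ U → 1 ≤ U → q ≢ + 0 →
    form (suc n) (c ◂ t) p q ≡ + 0 → abs c ≤ abs p ℕ.* (coefficient-sum n t ℕ.* U ℕ.^ n)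
  constant-dominated n c t p q U p≤U q≤U 1≤U q≢0 form≡0 = begin
      abs c                          ≤⟨ ≤*pos (abs c) (abs q ℕ.^ n) (1≤^ (abs q) n (nonzero⇒1≤abs q≢0)) ⟩
      abs c ℕ.* abs q ℕ.^ n          ≡⟨ zero-of-form n (c ◂ t) p q form≡0 ⟩
      abs p ℕ.* abs T                ≤⟨ ℕ.*-monoʳ-≤ (abs p) (ℕ.≤-trans (≤*pos (abs T) U 1≤U) (form-bound n t p q U p≤U q≤U)) ⟩
      abs p ℕ.* (coefficient-sum n t ℕ.* U ℕ.^ n) ∎
    where open ℕ.≤-Reasoning
          T = form n t p q

  two-lowest-terms : ∀ n c (t : Fin (suc n) → ℤ) p q → form (suc (suc n)) (c ◂ t) p q ≡ + 0 →
    abs p ℕ.* (abs p ℕ.* abs (form n (tail t) p q)) ≤ abs c ℕ.* abs q ℕ.^ suc n ℕ.+ abs p ℕ.* (abs (t zero) ℕ.* abs q ℕ.^ n)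
  two-lowest-terms n c t p q form≡0 = begin
      abs p ℕ.* (abs p ℕ.* abs Y)    ≡⟨ cong (abs p ℕ.*_) (sym (ℤ.abs-* p Y)) ⟩
      abs p ℕ.* abs (p ℤ.* Y)        ≡⟨ sym (ℤ.abs-* p (p ℤ.* Y)) ⟩
      abs (p ℤ.* (p ℤ.* Y))          ≡⟨ sym (ℤ.∣-i∣≡∣i∣ (p ℤ.* (p ℤ.* Y))) ⟩
      abs (ℤ.- (p ℤ.* (p ℤ.* Y)))    ≡⟨ cong abs (sym (x+y≡0⇒x≡-y {L} {p ℤ.* (p ℤ.* Y)} L+ppY≡0)) ⟩
      abs L                          ≤⟨ ℤ.∣i+j∣≤∣i∣+∣j∣ (c ℤ.* q ℤ.^ suc n) (p ℤ.* (t zero ℤ.* q ℤ.^ n)) ⟩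
      abs (c ℤ.* q ℤ.^ suc n) ℕ.+ abs (p ℤ.* (t zero ℤ.* q ℤ.^ n))
        ≡⟨ cong₂ ℕ._+_ (abs-*-^ c q (suc n)) (trans (ℤ.abs-* p _) (cong (abs p ℕ.*_) (abs-*-^ (t zero) q n))) ⟩
      abs c ℕ.* abs q ℕ.^ suc n ℕ.+ abs p ℕ.* (abs (t zero) ℕ.* abs q ℕ.^ n) ∎
    where
    open ℕ.≤-Reasoning
    Y = form n (tail t) p q
    L = c ℤ.* q ℤ.^ suc n ℤ.+ p ℤ.* (t zero ℤ.* q ℤ.^ n)
    L+ppY≡0 : L ℤ.+ p ℤ.* (p ℤ.* Y) ≡ + 0
    L+ppY≡0 = trans (solve 6 (λ c Q p t R y → (c :* Q :+ p :* (t :* R)) :+ p :* (p :* y) := c :* Q :+ p :* (t :* R :+ p :* y))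
                             refl c (q ℤ.^ suc n) p (t zero) (q ℤ.^ n) Y) form≡0
      where open ℤ-Solver

  -- How large the prime P must be for the constant term M·P (with higher
  -- coefficients t, the leading one of size L) to exclude all zeros.
  prime-bound : ∀ m → (Fin (suc (suc m)) → ℤ) → ℕ → ℕ
  prime-bound m t M = S ℕ.* U ℕ.^ suc (suc m) ℕ.+ (M ℕ.* L ℕ.^ suc (suc m) ℕ.+ abs (t zero) ℕ.* L ℕ.^ suc m) ℕ.+ S
    where L = abs (t (fromℕ (suc m)))
          S = coefficient-sum (suc (suc m)) t
          U = M ℕ.+ L

  -- At a zero p/q we have
  -- |q| ≤ L and p | M·P.  If P ∤ p then p | M and the constant term is
  -- too big to be cancelled; if P | p then the P-adic lemma makes the
  -- higher part Y nonzero and p² |Y| ≤ |p| (M L^d + |t₀| L^(d-1)) bounds p.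
  prime-constant-nonvanishing : ∀ m (t : Fin (suc (suc m)) → ℤ) M P p q → 1 ≤ M → Prime P →
    prime-bound m t M < P → t (fromℕ (suc m)) ≢ + 0 → p ≢ + 0 → q ≢ + 0 → Coprime (abs p) (abs q) →
    form (suc (suc (suc m))) (+ (M ℕ.* P) ◂ t) p q ≢ + 0
  prime-constant-nonvanishing m t M P p q 1≤M P-prime bound<P top≢0 p≢0 q≢0 p⊥q form≡0 = by-cases (P ∣? abs p)
    where
    open ℕ.≤-Reasoning
    d = suc (suc m)
    L = abs (t (fromℕ (suc m)))
    S = coefficient-sum d t
    U = M ℕ.+ L
    K₁ = S ℕ.* U ℕ.^ d
    K₂ = M ℕ.* L ℕ.^ d ℕ.+ abs (t zero) ℕ.* L ℕ.^ suc m
    K₁<P : K₁ < P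
    K₁<P = ℕ.≤-<-trans (ℕ.≤-trans (ℕ.m≤m+n K₁ K₂) (ℕ.m≤m+n (K₁ ℕ.+ K₂) S)) bound<P
    K₂<P : K₂ < P
    K₂<P = ℕ.≤-<-trans (ℕ.≤-trans (ℕ.m≤n+m K₂ K₁) (ℕ.m≤m+n (K₁ ℕ.+ K₂) S)) bound<P
    S<P : S < P
    S<P = ℕ.≤-<-trans (ℕ.m≤n+m S (K₁ ℕ.+ K₂)) bound<P
    q≤L : abs q ≤ L
    q≤L = ∣⇒≤ {{ℕ.>-nonZero (nonzero⇒1≤abs top≢0)}} (root-denominator∣leading d (+ (M ℕ.* P) ◂ t) p q form≡0 p⊥q)
    P∤p⇒P≤K₁ : ¬ (P ∣ abs p) → P ≤ K₁
    P∤p⇒P≤K₁ P∤p = ℕ.*-cancelˡ-≤ M {{ℕ.>-nonZero 1≤M}} (begin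
        M ℕ.* P                  ≤⟨ constant-dominated d (+ (M ℕ.* P)) t p q U (ℕ.≤-trans p≤M (ℕ.m≤m+n M L))
                                      (ℕ.≤-trans q≤L (ℕ.m≤n+m L M)) (ℕ.≤-trans 1≤M (ℕ.m≤m+n M L)) q≢0 form≡0 ⟩
        abs p ℕ.* K₁             ≤⟨ ℕ.*-monoˡ-≤ K₁ p≤M ⟩
        M ℕ.* K₁                 ∎)
      where
      p⊥P : Coprime (abs p) P
      p⊥P {k} (k∣p , k∣P) with prime⇒irreducible P-prime k∣P
      ... | inj₁ k≡1 = k≡1
      ... | inj₂ k≡P = ⊥-elim (P∤p (subst (_∣ abs p) k≡P k∣p))
      p≤M : abs p ≤ M
      p≤M = ∣⇒≤ {{ℕ.>-nonZero 1≤M}} (Coprimality.coprime-divisor p⊥P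
              (subst (abs p ∣_) (ℕ.*-comm M P) (root-numerator∣constant d (+ (M ℕ.* P) ◂ t) p q form≡0 p⊥q)))
    P∣p⇒p≤K₂ : P ∣ abs p → abs p ≤ K₂
    P∣p⇒p≤K₂ P∣p = ℕ.*-cancelˡ-≤ (abs p) {{ℕ.>-nonZero (nonzero⇒1≤abs p≢0)}} (begin
        abs p ℕ.* abs p          ≤⟨ ℕ.*-monoʳ-≤ (abs p) (≤*pos (abs p) (abs Y) (nonzero⇒1≤abs Y≢0)) ⟩
        abs p ℕ.* (abs p ℕ.* abs Y)
                                 ≤⟨ two-lowest-terms (suc m) (+ (M ℕ.* P)) t p q form≡0 ⟩
        (M ℕ.* P) ℕ.* abs q ℕ.^ d ℕ.+ abs p ℕ.* (abs (t zero) ℕ.* abs q ℕ.^ suc m)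
                                 ≤⟨ ℕ.+-mono-≤ (ℕ.*-monoʳ-≤ (M ℕ.* P) (ℕ.^-monoˡ-≤ d q≤L))
                                               (ℕ.*-monoʳ-≤ (abs p) (ℕ.*-monoʳ-≤ (abs (t zero)) (ℕ.^-monoˡ-≤ (suc m) q≤L))) ⟩
        (M ℕ.* P) ℕ.* L ℕ.^ d ℕ.+ abs p ℕ.* (abs (t zero) ℕ.* L ℕ.^ suc m)
                                 ≡⟨ cong (ℕ._+ abs p ℕ.* (abs (t zero) ℕ.* L ℕ.^ suc m))
                                         (solve 3 (λ M P c → (M :* P) :* c := P :* (M :* c)) refl M P (L ℕ.^ d)) ⟩
        P ℕ.* (M ℕ.* L ℕ.^ d) ℕ.+ abs p ℕ.* (abs (t zero) ℕ.* L ℕ.^ suc m)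
                                 ≤⟨ ℕ.+-monoˡ-≤ _ (ℕ.*-monoˡ-≤ (M ℕ.* L ℕ.^ d) P≤p) ⟩
        abs p ℕ.* (M ℕ.* L ℕ.^ d) ℕ.+ abs p ℕ.* (abs (t zero) ℕ.* L ℕ.^ suc m)
                                 ≡⟨ sym (ℕ.*-distribˡ-+ (abs p) _ _) ⟩
        abs p ℕ.* K₂             ∎)
      where
      open ℕ-Solver
      P≤p : P ≤ abs p
      P≤p = ∣⇒≤ {{ℕ.>-nonZero (nonzero⇒1≤abs p≢0)}} P∣p
      P∤q : ¬ (P ∣ abs q)
      P∤q P∣q = ℕ.<⇒≱ (ℕ.≤-<-trans q≤L (ℕ.≤-<-trans (coefficient≤sum d t (fromℕ (suc m))) S<P))
                      (∣⇒≤ {{ℕ.>-nonZero (nonzero⇒1≤abs q≢0)}} P∣q)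
      Y = form (suc m) (tail t) p q
      Y≢0 : Y ≢ + 0
      Y≢0 = P-adic-nonvanishing m (tail t) P p q P-prime top≢0
              (λ j → ℕ.≤-<-trans (coefficient≤sum d t (suc j)) S<P) P∤q P∣p p≢0
    by-cases : Dec (P ∣ abs p) → ⊥
    by-cases (no  P∤p) = ℕ.<⇒≱ K₁<P (P∤p⇒P≤K₁ P∤p)
    by-cases (yes P∣p) = ℕ.<⇒≱ K₂<P (ℕ.≤-trans (∣⇒≤ {{ℕ.>-nonZero (nonzero⇒1≤abs p≢0)}} P∣p) (P∣p⇒p≤K₂ P∣p))

module Completion where

  open RationalArithmetic using (_^_)
  open RationalPolynomials using (eval-differ-at)

  Completes : ∀ {n} → Fin n → ℚ → (Fin n → ℚ) → (Fin n → ℚ) → Set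
  Completes i x b A = A i ≡ x × (∀ j → j ≢ i → A j ≡ b j)

  set : ∀ {n} → Fin n → ℚ → (Fin n → ℚ) → Fin n → ℚ
  set zero    x b zero    = x
  set zero    x b (suc j) = b (suc j)
  set (suc i) x b zero    = b zero
  set (suc i) x b (suc j) = set i x (tail b) j

  set-at : ∀ {n} (i : Fin n) x b → set i x b i ≡ x
  set-at zero    x b = refl
  set-at (suc i) x b = set-at i x (tail b)

  set-off : ∀ {n} (i j : Fin n) x b → j ≢ i → set i x b j ≡ b j
  set-off zero    zero    x b j≢i = ⊥-elim (j≢i refl)
  set-off zero    (suc j) x b j≢i = refl
  set-off (suc i) zero    x b j≢i = refl
  set-off (suc i) (suc j) x b j≢i = set-off i j x (tail b) (j≢i ∘ cong suc)

  eval-completion : ∀ n i a b A → Completes i a b A → ∀ x →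
                    eval n A x ≡ eval n (set i 0ℚ b) x + a * x ^ toℕ i
  eval-completion n i a b A (A-at , A-off) x = begin
      eval n A x                                          ≡⟨ eval-differ-at n A B i (λ j j≢i → trans (A-off j j≢i) (sym (set-off i j 0ℚ b j≢i))) x ⟩
      eval n B x + (A i - B i) * x ^ toℕ i                ≡⟨ cong₂ (λ u v → eval n B x + (u - v) * x ^ toℕ i) A-at (set-at i 0ℚ b) ⟩
      eval n B x + (a - 0ℚ) * x ^ toℕ i                   ≡⟨ solve 3 (λ e a y → e :+ (a :- con 0ℚ) :* y := e :+ a :* y) refl (eval n B x) a (x ^ toℕ i) ⟩
      eval n B x + a * x ^ toℕ i                          ∎
    where open ≡-Reasoning
          open +-*-Solver
          B = set i 0ℚ b

module ClearingDenominators where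

  open RationalArithmetic
  open IntegerEmbedding
  open RationalPolynomials
  open IntegerForms
  open +-*-Solver

  ι-form : ∀ n c p q → ι (form n c p q) ≡ formℚ n (ι ∘ c) (ι p) (ι q)
  ι-form zero    c p q = refl
  ι-form (suc n) c p q =
    trans (ι-+ (c zero ℤ.* q ℤ.^ n) (p ℤ.* form n (tail c) p q))
          (cong₂ _+_ (trans (ι-* (c zero) (q ℤ.^ n)) (cong (ι (c zero) *_) (ι-^ q n)))
                     (trans (ι-* p (form n (tail c) p q)) (cong (ι p *_) (ι-form n (tail c) p q))))

  clear-denominators : ∀ n (b : Fin n → ℚ) →
    Σ ℕ λ M → 1 ≤ M × Σ (Fin n → ℤ) λ G → ∀ j → ι (G j) ≡ ι (+ M) * b j
  clear-denominators zero    b = 1 , s≤s z≤n , (λ ()) , (λ ())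
  clear-denominators (suc n) b with clear-denominators n (tail b)
  ... | M , 1≤M , G , G≡Mb = e ℕ.* M , ℕ.*-mono-≤ {1} {e} (s≤s z≤n) 1≤M , ↥ b₀ ℤ.* + M ◂ (λ j → + e ℤ.* G j) , scaled
    where
    open ≡-Reasoning
    b₀ = b zero
    e = ↧ₙ b₀
    ι-eM : ι (+ (e ℕ.* M)) ≡ ι (+ e) * ι (+ M)
    ι-eM = trans (cong ι (ℤ.pos-* e M)) (ι-* (+ e) (+ M))
    scaled : ∀ j → ι ((↥ b₀ ℤ.* + M ◂ (λ j → + e ℤ.* G j)) j) ≡ ι (+ (e ℕ.* M)) * b j
    scaled zero = begin
      ι (↥ b₀ ℤ.* + M)              ≡⟨ ι-* (↥ b₀) (+ M) ⟩
      ι (↥ b₀) * ι (+ M)            ≡⟨ cong (_* ι (+ M)) (sym (↧*≡↥ b₀)) ⟩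
      (ι (+ e) * b₀) * ι (+ M)      ≡⟨ solve 3 (λ x y z → (x :* y) :* z := (x :* z) :* y) refl (ι (+ e)) b₀ (ι (+ M)) ⟩
      (ι (+ e) * ι (+ M)) * b₀      ≡⟨ cong (_* b₀) (sym ι-eM) ⟩
      ι (+ (e ℕ.* M)) * b₀          ∎
    scaled (suc j) = begin
      ι (+ e ℤ.* G j)               ≡⟨ ι-* (+ e) (G j) ⟩
      ι (+ e) * ι (G j)             ≡⟨ cong (ι (+ e) *_) (G≡Mb j) ⟩
      ι (+ e) * (ι (+ M) * b (suc j)) ≡⟨ sym (*-assoc (ι (+ e)) (ι (+ M)) (b (suc j))) ⟩
      (ι (+ e) * ι (+ M)) * b (suc j) ≡⟨ cong (_* b (suc j)) (sym ι-eM) ⟩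
      ι (+ (e ℕ.* M)) * b (suc j)   ∎

  root⇒form-zero : ∀ n (A : Fin (suc n) → ℚ) (F : Fin (suc n) → ℤ) M r → (∀ j → ι (F j) ≡ ι (+ M) * A j) →
                   eval (suc n) A r ≡ 0ℚ → form (suc n) F (↥ r) (↧ r) ≡ + 0
  root⇒form-zero n A F M r F≡MA root = ι-injective (begin
      ι (form (suc n) F p q)                            ≡⟨ ι-form (suc n) F p q ⟩
      formℚ (suc n) (ι ∘ F) (ι p) (ι q)                 ≡⟨ formℚ-cong (suc n) F≡MA (ι p) (ι q) ⟩
      formℚ (suc n) MA (ι p) (ι q)                      ≡⟨ sym (formℚ-eval n MA (ι p) (ι q) r (↧*≡↥ r)) ⟩
      ι q ^ n * eval (suc n) MA r                       ≡⟨ cong (ι q ^ n *_) (eval-scale (suc n) (ι (+ M)) A r) ⟩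
      ι q ^ n * (ι (+ M) * eval (suc n) A r)            ≡⟨ cong (λ v → ι q ^ n * (ι (+ M) * v)) root ⟩
      ι q ^ n * (ι (+ M) * 0ℚ)                          ≡⟨ solve 2 (λ a b → a :* (b :* con 0ℚ) := con 0ℚ) refl (ι q ^ n) (ι (+ M)) ⟩
      0ℚ                                                ∎)
    where open ≡-Reasoning
          p = ↥ r
          q = ↧ r
          MA = λ j → ι (+ M) * A j

  numerator-denominator-coprime : ∀ r → Coprime (abs (↥ r)) (abs (↧ r))
  numerator-denominator-coprime (mkℚ _ _ coprime) = Coprimality.recompute coprime

  denominator≢0 : ∀ r → ↧ r ≢ + 0
  denominator≢0 (mkℚ _ _ _) ()

  root-numerator≢0 : ∀ n (A : Fin (suc n) → ℚ) r → A zero ≢ 0ℚ → eval (suc n) A r ≡ 0ℚ → ↥ r ≢ + 0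
  root-numerator≢0 n A r A₀≢0 root ↥r≡0 =
    A₀≢0 (trans (sym (eval-at-0 n A)) (trans (cong (eval (suc n) A) (sym (↥p≡0⇒p≡0 r ↥r≡0))) root))

  no-zero⇒no-root : ∀ n (A : Fin (suc n) → ℚ) (F : Fin (suc n) → ℤ) M → (∀ j → ι (F j) ≡ ι (+ M) * A j) →
    A zero ≢ 0ℚ →
    (∀ p q → p ≢ + 0 → q ≢ + 0 → Coprime (abs p) (abs q) → form (suc n) F p q ≢ + 0) →
    ∀ r → eval (suc n) A r ≢ 0ℚ
  no-zero⇒no-root n A F M F≡MA A₀≢0 no-zero r root =
    no-zero (↥ r) (↧ r) (root-numerator≢0 n A r A₀≢0 root) (denominator≢0 r) (numerator-denominator-coprime r)
            (root⇒form-zero n A F M r F≡MA root)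

module NoraLastMove where

  open RationalArithmetic
  open IntegerEmbedding
  open IntegerForms
  open Primes
  open NonvanishingForms
  open ClearingDenominators
  open Completion

  NoraMove : ∀ d → Fin (suc d) → (Fin (suc d) → ℚ) → Set
  NoraMove d i b = Σ ℤ λ X → ι X ≢ 0ℚ × (∀ A → Completes i (ι X) b A → ∀ r → eval (suc d) A r ≢ 0ℚ)

  -- Scale b (with position i emptied) to an integer vector G = M·b; the
  -- move X then yields the integer vector G + M·X·e_i.  For a middle
  -- position X is huge, for the constant term X is a large prime, and the
  -- leading position is the constant one for the reversed polynomial.
  nora-last-move : ∀ d → 2 ≤ d → ∀ i (b : Fin (suc d) → ℚ) →
    (zero ≢ i → b zero ≢ 0ℚ) → (fromℕ d ≢ i → b (fromℕ d) ≢ 0ℚ) → NoraMove d i b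
  nora-last-move d@(suc (suc m)) (s≤s (s≤s z≤n)) i b b₀≢0 b_d≢0 with clear-denominators (suc d) (set i 0ℚ b)
  ... | M , 1≤M , G , G≡Mb = by-position (zero Fin.≟ i) (fromℕ d Fin.≟ i)
    where
    G-at : G i ≡ + 0
    G-at = ι-injective (trans (G≡Mb i) (trans (cong (ι (+ M) *_) (set-at i 0ℚ b)) (*-zeroʳ (ι (+ M)))))
    G-off : ∀ j → j ≢ i → ι (G j) ≡ ι (+ M) * b j
    G-off j j≢i = trans (G≡Mb j) (cong (ι (+ M) *_) (set-off i j 0ℚ b j≢i))
    G-nonzero : ∀ j → j ≢ i → b j ≢ 0ℚ → G j ≢ + 0
    G-nonzero j j≢i bj≢0 Gj≡0 = *-nonzero (ι-pos≢0 1≤M) bj≢0 (trans (sym (G-off j j≢i)) (cong ι Gj≡0))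

    F : ℤ → Fin (suc d) → ℤ
    F X j = G j ℤ.+ single i (+ M ℤ.* X) j
    F-at : ∀ X → F X i ≡ + M ℤ.* X
    F-at X = trans (cong₂ ℤ._+_ G-at (single-at i (+ M ℤ.* X))) (ℤ.+-identityˡ (+ M ℤ.* X))
    F-off : ∀ X j → j ≢ i → F X j ≡ G j
    F-off X j j≢i = trans (cong (λ v → G j ℤ.+ v) (single-off i j (+ M ℤ.* X) j≢i)) (ℤ.+-identityʳ (G j))
    F-scaled : ∀ X A → Completes i (ι X) b A → ∀ j → ι (F X j) ≡ ι (+ M) * A j
    F-scaled X A (A-at , A-off) j with j Fin.≟ i
    ... | yes refl = trans (cong ι (F-at X)) (trans (ι-* (+ M) X) (cong (ι (+ M) *_) (sym A-at)))
    ... | no  j≢i  = trans (cong ι (F-off X j j≢i)) (trans (G-off j j≢i) (cong (ι (+ M) *_) (sym (A-off j j≢i))))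

    suffices : ∀ X → ι X ≢ 0ℚ →
      (∀ p q → p ≢ + 0 → q ≢ + 0 → Coprime (abs p) (abs q) → form (suc d) (F X) p q ≢ + 0) → NoraMove d i b
    suffices X ιX≢0 no-zero = X , ιX≢0 , λ A A-completes@(A-at , A-off) →
        no-zero⇒no-root d A (F X) M (F-scaled X A A-completes) (A₀≢0 A A-at A-off (zero Fin.≟ i)) no-zero
      where
      A₀≢0 : ∀ A → A i ≡ ι X → (∀ j → j ≢ i → A j ≡ b j) → Dec (zero ≡ i) → A zero ≢ 0ℚ
      A₀≢0 A A-at A-off (yes refl) A₀≡0 = ιX≢0 (trans (sym A-at) A₀≡0)
      A₀≢0 A A-at A-off (no 0≢i)   A₀≡0 = b₀≢0 0≢i (trans (sym (A-off zero 0≢i)) A₀≡0)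

    by-position : Dec (zero ≡ i) → Dec (fromℕ d ≡ i) → NoraMove d i b
    by-position (no i≢0) (no i≢d) = suffices X (ι-suc≢0 Y) λ p q p≢0 q≢0 p⊥q →
        large-middle-nonvanishing d G i (+ M ℤ.* X) p q (G-nonzero zero i≢0 (b₀≢0 i≢0))
          (G-nonzero (fromℕ d) i≢d (b_d≢0 i≢d)) i≢0 i≢d Y<MX p≢0 q≢0 p⊥q
      where
      Y = coefficient-sum (suc d) G ℕ.* (abs (G zero) ℕ.+ abs (G (fromℕ d))) ℕ.^ suc d
      X = + suc Y
      Y<MX : Y < abs (+ M ℤ.* X)
      Y<MX = ℕ.≤-trans (ℕ.m≤n*m (suc Y) M {{ℕ.>-nonZero 1≤M}}) (ℕ.≤-reflexive (sym (ℤ.abs-* (+ M) X)))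
    by-position (yes refl) _ with prime-above (prime-bound m (tail G) M)
    ... | P , P-prime , bound<P = suffices (+ P) (ι-pos≢0 (ℕ.<⇒≤ (1<prime P-prime))) λ p q p≢0 q≢0 p⊥q form≡0 →
        prime-constant-nonvanishing m (tail G) M P p q 1≤M P-prime bound<P
          (G-nonzero (fromℕ d) (λ ()) (b_d≢0 (λ ()))) p≢0 q≢0 p⊥q
          (trans (form-cong (suc d) (λ j → sym (F≗ j)) p q) form≡0)
      where
      F≗ : ∀ j → F (+ P) j ≡ (+ (M ℕ.* P) ◂ tail G) j
      F≗ zero    = trans (F-at (+ P)) (sym (ℤ.pos-* M P))
      F≗ (suc j) = F-off (+ P) (suc j) (λ ())
    by-position (no i≢0) (yes refl) with prime-above (prime-bound m (tail (G ∘ opposite)) M)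
    ... | P , P-prime , bound<P = suffices (+ P) (ι-pos≢0 (ℕ.<⇒≤ (1<prime P-prime))) λ p q p≢0 q≢0 p⊥q form≡0 →
        prime-constant-nonvanishing m t M P q p 1≤M P-prime bound<P t-top≢0 q≢0 p≢0 (Coprimality.sym p⊥q)
          (trans (form-cong (suc d) (λ j → sym (F≗ j)) q p) (trans (sym (form-reverse d (F (+ P)) p q)) form≡0))
      where
      t = tail (G ∘ opposite)
      t-top≢0 : t (fromℕ (suc m)) ≢ + 0
      t-top≢0 = subst (λ k → G k ≢ + 0) (sym (Fin.opposite-involutive {suc d} zero)) (G-nonzero zero i≢0 (b₀≢0 i≢0))
      F≗ : ∀ j → F (+ P) (opposite j) ≡ (+ (M ℕ.* P) ◂ t) j
      F≗ zero    = trans (F-at (+ P)) (sym (ℤ.pos-* M P))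
      F≗ (suc j) = F-off (+ P) (inject₁ (opposite j)) (λ e → Fin.fromℕ≢inject₁ (sym e))

-- Wanda, making the last move at position i, can choose a value in D
-- after which the polynomial has a root in the fraction field of D:
-- the root 1 for a middle position, an integer root for the constant
-- term and the reciprocal of an integer for the leading coefficient.
module WandaLastMove (R : SubringZQ) where

  open SubringZQ R
  open RationalArithmetic
  open IntegerEmbedding
  open RationalPolynomials
  open Completion
  open +-*-Solver

  eval-in-D : ∀ n c x → (∀ j → D (c j)) → D x → D (eval n c x)
  eval-in-D zero    c x c∈D x∈D = D-0
  eval-in-D (suc n) c x c∈D x∈D = D-+ (c∈D zero) (D-* x∈D (eval-in-D n (tail c) x (c∈D ∘ suc) x∈D))

  ^-in-D : ∀ q n → D q → D (q ^ n)
  ^-in-D q zero    q∈D = D-1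
  ^-in-D q (suc n) q∈D = D-* q∈D (^-in-D q n q∈D)

  formℚ-in-D : ∀ n c p q → (∀ j → D (c j)) → D p → D q → D (formℚ n c p q)
  formℚ-in-D zero    c p q c∈D p∈D q∈D = D-0
  formℚ-in-D (suc n) c p q c∈D p∈D q∈D =
    D-+ (D-* (c∈D zero) (^-in-D q n q∈D)) (D-* p∈D (formℚ-in-D n (tail c) p q (c∈D ∘ suc) p∈D q∈D))

  integer-root : ∀ n A z → eval n A (ι z) ≡ 0ℚ → HasRootInFrac R n A
  integer-root n A z root = ι z , (ι z , 1ℚ , D-⊇ℤ z , D-1 , (λ ()) , *-identityʳ (ι z)) , root

  reciprocal-root : ∀ n A k → eval n A (recip k) ≡ 0ℚ → HasRootInFrac R n A
  reciprocal-root n A k root = recip k , (1ℚ , ι (+ suc k) , D-1 , D-⊇ℤ (+ suc k) , ι-suc≢0 k , recip*ι-suc k) , root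

  WandaMove : ∀ d → Fin (suc d) → (Fin (suc d) → ℚ) → Set
  WandaMove d i b = Σ ℚ λ a → D a × ((i ≡ zero ⊎ i ≡ fromℕ d) → a ≢ 0ℚ) ×
                              (∀ A → Completes i a b A → HasRootInFrac R (suc d) A)

  wanda-last-move : ∀ d → 1 ≤ d → ∀ i (b : Fin (suc d) → ℚ) → (∀ j → j ≢ i → D (b j)) →
    (zero ≢ i → b zero ≢ 0ℚ) → (fromℕ d ≢ i → b (fromℕ d) ≢ 0ℚ) → WandaMove d i b
  wanda-last-move d@(suc e) (s≤s z≤n) i b b∈D b₀≢0 b_d≢0 = by-position (zero Fin.≟ i) (fromℕ d Fin.≟ i)
    where
    B = set i 0ℚ b
    B∈D : ∀ j → D (B j)
    B∈D j with j Fin.≟ i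
    ... | yes refl = subst D (sym (set-at i 0ℚ b)) D-0
    ... | no  j≢i  = subst D (sym (set-off i j 0ℚ b j≢i)) (b∈D j j≢i)

    by-position : Dec (zero ≡ i) → Dec (fromℕ d ≡ i) → WandaMove d i b
    -- middle position: make 1 a root, a = -(sum of the other coefficients)
    by-position (no i≢0) (no i≢d) = a , D-neg (eval-in-D (suc d) B 1ℚ B∈D D-1) , not-an-end , λ A A-completes →
        integer-root (suc d) A (+ 1) (begin
          eval (suc d) A 1ℚ           ≡⟨ eval-completion (suc d) i a b A A-completes 1ℚ ⟩
          E + a * 1ℚ ^ toℕ i          ≡⟨ cong (λ v → E + a * v) (1^n≡1 (toℕ i)) ⟩
          E + (- E) * 1ℚ              ≡⟨ solve 1 (λ E → E :+ (:- E) :* con 1ℚ := con 0ℚ) refl E ⟩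
          0ℚ                          ∎)
      where
      open ≡-Reasoning
      E = eval (suc d) B 1ℚ
      a = - E
      not-an-end : (i ≡ zero ⊎ i ≡ fromℕ d) → a ≢ 0ℚ
      not-an-end (inj₁ i≡0) = ⊥-elim (i≢0 (sym i≡0))
      not-an-end (inj₂ i≡d) = ⊥-elim (i≢d (sym i≡d))
    -- constant term: f = a + x·g(x) with g ≠ 0 of degree < d, so g(x) ≠ 0
    -- for some x ∈ {1, …, d}; then a = -x·g(x) makes x a root
    by-position (yes refl) _ = from-nonroot (nonzero-at-some-point d (tail b) (λ k → ι (+ suc k)) ι-suc-injective
                                   (λ g≡0 → b_d≢0 (λ ()) (zero-function⇒zero-coefficients d (tail b) g≡0 (fromℕ e))))
      where
      open ≡-Reasoning
      from-nonroot : Σ ℕ (λ k → eval d (tail b) (ι (+ suc k)) ≢ 0ℚ) → WandaMove d zero b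
      from-nonroot (k , g[x]≢0) = a , D-neg (D-* (D-⊇ℤ (+ suc k)) (eval-in-D d (tail b) x (λ j → b∈D (suc j) (λ ())) (D-⊇ℤ (+ suc k)))) ,
                                  (λ _ → neg-nonzero (*-nonzero (ι-suc≢0 k) g[x]≢0)) , λ A (A-at , A-off) →
          integer-root (suc d) A (+ suc k) (begin
            A zero + x * eval d (tail A) x   ≡⟨ cong₂ (λ u v → u + x * v) A-at (eval-cong d (λ j → A-off (suc j) (λ ())) x) ⟩
            a + x * eval d (tail b) x        ≡⟨ solve 2 (λ x g → (:- (x :* g)) :+ x :* g := con 0ℚ) refl x (eval d (tail b) x) ⟩
            0ℚ                               ∎)
        where
        x = ι (+ suc k)
        a = - (x * eval d (tail b) x)
    -- leading coefficient: f(1/q) = f₀(1/q) + a/q^d with f₀ = f - a xᵈ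
    -- nonzero at some 1/q; a = -q^d f₀(1/q), which is in D as the
    -- homogenised value formℚ f₀ 1 q, makes 1/q a root
    by-position (no i≢0) (yes refl) = from-nonroot (nonzero-at-some-point (suc d) B recip recip-injective
                                          (λ f₀≡0 → b₀≢0 i≢0 (trans (sym (set-off i zero 0ℚ b i≢0))
                                                                    (trans (sym (eval-at-0 d B)) (f₀≡0 0ℚ)))))
      where
      open ≡-Reasoning
      from-nonroot : Σ ℕ (λ k → eval (suc d) B (recip k) ≢ 0ℚ) → WandaMove d i b
      from-nonroot (k , f₀[r]≢0) = a , D-neg (formℚ-in-D (suc d) B 1ℚ q B∈D D-1 (D-⊇ℤ (+ suc k))) ,
                                   (λ _ → neg-nonzero H≢0) , λ A A-completes →
          reciprocal-root (suc d) A k (*-cancel-nonzeroˡ (begin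
            q ^ d * eval (suc d) A r                   ≡⟨ cong (q ^ d *_) (eval-completion (suc d) i a b A A-completes r) ⟩
            q ^ d * (E + a * r ^ toℕ (fromℕ d))        ≡⟨ cong (λ n → q ^ d * (E + a * r ^ n)) (Fin.toℕ-fromℕ d) ⟩
            q ^ d * (E + a * r ^ d)                    ≡⟨ solve 4 (λ w E a v → w :* (E :+ a :* v) := w :* E :+ a :* (w :* v)) refl (q ^ d) E a (r ^ d) ⟩
            q ^ d * E + a * (q ^ d * r ^ d)            ≡⟨ cong₂ (λ u v → u + a * v) qᵈE≡H (trans (^-distrib-* q r d) (trans (cong (_^ d) (ι-suc*recip k)) (1^n≡1 d))) ⟩
            H + a * 1ℚ                                 ≡⟨ solve 1 (λ H → H :+ (:- H) :* con 1ℚ := con 0ℚ) refl H ⟩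
            0ℚ                                         ∎) (^-nonzero d (ι-suc≢0 k)))
        where
        q = ι (+ suc k)
        r = recip k
        E = eval (suc d) B r
        H = formℚ (suc d) B 1ℚ q
        qᵈE≡H : q ^ d * E ≡ H
        qᵈE≡H = formℚ-eval d B 1ℚ q r (ι-suc*recip k)
        H≢0 : H ≢ 0ℚ
        H≢0 H≡0 = *-nonzero (^-nonzero d (ι-suc≢0 k)) f₀[r]≢0 (trans qᵈE≡H H≡0)
        a = - H

module UnfilledSlots where

  unfilled-slot : Maybe ℚ → ℕ
  unfilled-slot nothing  = 1
  unfilled-slot (just _) = 0

  unfilled : ∀ n → (Fin n → Maybe ℚ) → ℕ
  unfilled zero    c = 0
  unfilled (suc n) c = unfilled-slot (c zero) ℕ.+ unfilled n (tail c)

  unfilled-cong : ∀ n {c c′ : Fin n → Maybe ℚ} → (∀ j → c j ≡ c′ j) → unfilled n c ≡ unfilled n c′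
  unfilled-cong zero    c≡c′ = refl
  unfilled-cong (suc n) c≡c′ = cong₂ ℕ._+_ (cong unfilled-slot (c≡c′ zero)) (unfilled-cong n (c≡c′ ∘ suc))

  unfilled-fill : ∀ n (c c′ : Fin n → Maybe ℚ) i a → c i ≡ nothing → c′ i ≡ just a →
                  (∀ j → j ≢ i → c′ j ≡ c j) → unfilled n c ≡ suc (unfilled n c′)
  unfilled-fill (suc n) c c′ zero a cᵢ≡nothing c′ᵢ≡a c′≡c rewrite cᵢ≡nothing | c′ᵢ≡a =
    cong suc (unfilled-cong n (λ j → sym (c′≡c (suc j) (λ ()))))
  unfilled-fill (suc n) c c′ (suc i) a cᵢ≡nothing c′ᵢ≡a c′≡c =
    trans (cong₂ ℕ._+_ (cong unfilled-slot (sym (c′≡c zero (λ ()))))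
                       (unfilled-fill n (tail c) (tail c′) i a cᵢ≡nothing c′ᵢ≡a (λ j j≢i → c′≡c (suc j) (j≢i ∘ Fin.suc-injective))))
          (ℕ.+-suc (unfilled-slot (c′ zero)) (unfilled n (tail c′)))

  some-unfilled : ∀ n (c : Fin n → Maybe ℚ) k → unfilled n c ≡ suc k → Σ (Fin n) λ i → c i ≡ nothing
  some-unfilled (suc n) c k count with c zero in c₀
  ... | nothing = zero , c₀
  ... | just _  with some-unfilled n (tail c) k count
  ...   | i , cᵢ≡nothing = suc i , cᵢ≡nothing

  none-unfilled : ∀ n (c : Fin n → Maybe ℚ) → unfilled n c ≡ 0 → ∀ j → c j ≡ just (fromMaybe 0ℚ (c j))
  none-unfilled (suc n) c count j with c zero in c₀
  none-unfilled (suc n) c ()    j       | nothing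
  none-unfilled (suc n) c count zero    | just x = trans c₀ (cong (just ∘ fromMaybe 0ℚ) (sym c₀))
  none-unfilled (suc n) c count (suc j) | just x = none-unfilled n (tail c) count j

  all-unfilled : ∀ n → unfilled n (λ _ → nothing) ≡ n
  all-unfilled zero    = refl
  all-unfilled (suc n) = cong suc (all-unfilled n)

-- Until
-- then p plays the harmless value 1 anywhere; the invariant is that all
-- chosen coefficients are legal, and the induction is on the number of
-- unfilled slots.
module Game (R : SubringZQ) (d : ℕ) (2≤d : 2 ≤ d) where

  open SubringZQ R
  open IntegerEmbedding using (ι)
  open Completion using (Completes)
  open WandaLastMove R using (wanda-last-move)
  open NoraLastMove using (nora-last-move)
  open UnfilledSlots

  End : Fin (suc d) → Set
  End j = j ≡ zero ⊎ j ≡ fromℕ d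

  Legal : Position d → Set
  Legal c = ∀ j x → c j ≡ just x → D x × (End j → x ≢ 0ℚ)

  legal-empty : Legal (emptyPos d)
  legal-empty j x ()

  update-at : ∀ (c : Position d) i a → update c i a i ≡ just a
  update-at c i a with i Fin.≟ i
  ... | yes _   = refl
  ... | no  i≢i = ⊥-elim (i≢i refl)

  update-off : ∀ (c : Position d) i a j → j ≢ i → update c i a j ≡ c j
  update-off c i a j j≢i with j Fin.≟ i
  ... | yes j≡i = ⊥-elim (j≢i j≡i)
  ... | no  _   = refl

  legal-update : ∀ c i a → Legal c → LegalMove R d c i a → Legal (update c i a)
  legal-update c i a legal (_ , a∈D , a≢0) j x cⱼ≡x = by-cases (j Fin.≟ i)
    where
    by-cases : Dec (j ≡ i) → D x × (End j → x ≢ 0ℚ)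
    by-cases (yes refl) = subst (λ v → D v × (End j → v ≢ 0ℚ))
                                (Maybe.just-injective (trans (sym (update-at c j a)) cⱼ≡x)) (a∈D , a≢0)
    by-cases (no  j≢i)  = legal j x (trans (sym (update-off c i a j j≢i)) cⱼ≡x)

  unfilled-update : ∀ c i a → c i ≡ nothing → unfilled (suc d) c ≡ suc (unfilled (suc d) (update c i a))
  unfilled-update c i a cᵢ≡nothing = unfilled-fill (suc d) c (update c i a) i a cᵢ≡nothing (update-at c i a) (update-off c i a)

  LastMove : Player → Fin (suc d) → (Fin (suc d) → ℚ) → Set
  LastMove p i b = Σ ℚ λ a → D a × (End i → a ≢ 0ℚ) × (∀ A → Completes i a b A → WinnerIs R (suc d) A p)

  last-move : ∀ p i (b : Fin (suc d) → ℚ) → (∀ j → j ≢ i → D (b j)) →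
              (zero ≢ i → b zero ≢ 0ℚ) → (fromℕ d ≢ i → b (fromℕ d) ≢ 0ℚ) → LastMove p i b
  last-move Wanda i b b∈D b₀≢0 b_d≢0 = wanda-last-move d (ℕ.<⇒≤ 2≤d) i b b∈D b₀≢0 b_d≢0
  last-move Nora  i b b∈D b₀≢0 b_d≢0 with nora-last-move d 2≤d i b b₀≢0 b_d≢0
  ... | X , ιX≢0 , no-root = ι X , D-⊇ℤ X , (λ _ → ιX≢0) , λ A A-completes (r , _ , root) → no-root A A-completes r root

  finish : ∀ p c → Legal c → unfilled (suc d) c ≡ 1 → Wins R d p p c
  finish p c legal one-left = play (some-unfilled (suc d) c 0 one-left)
    where
    play : Σ (Fin (suc d)) (λ i → c i ≡ nothing) → Wins R d p p c
    play (i , cᵢ≡nothing) = complete (last-move p i b b∈D b₀≢0 b_d≢0)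
      where
      full-after : ∀ a j → update c i a j ≡ just (fromMaybe 0ℚ (update c i a j))
      full-after a = none-unfilled (suc d) (update c i a)
                       (ℕ.suc-injective (trans (sym (unfilled-update c i a cᵢ≡nothing)) one-left))
      b : Fin (suc d) → ℚ
      b j = fromMaybe 0ℚ (c j)
      filled : ∀ j → j ≢ i → c j ≡ just (b j)
      filled j j≢i = trans (sym (update-off c i 0ℚ j j≢i))
                           (trans (full-after 0ℚ j) (cong (just ∘ fromMaybe 0ℚ) (update-off c i 0ℚ j j≢i)))
      b∈D : ∀ j → j ≢ i → D (b j)
      b∈D j j≢i = proj₁ (legal j (b j) (filled j j≢i))
      b₀≢0 : zero ≢ i → b zero ≢ 0ℚ
      b₀≢0 0≢i = proj₂ (legal zero (b zero) (filled zero 0≢i)) (inj₁ refl)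
      b_d≢0 : fromℕ d ≢ i → b (fromℕ d) ≢ 0ℚ
      b_d≢0 d≢i = proj₂ (legal (fromℕ d) (b (fromℕ d)) (filled (fromℕ d) d≢i)) (inj₂ refl)
      complete : LastMove p i b → Wins R d p p c
      complete (a , a∈D , a≢0 , wins) =
        ownMove i a (cᵢ≡nothing , a∈D , a≢0) (finished A (full-after a) (wins A (A-at , A-off)))
        where
        A : Fin (suc d) → ℚ
        A j = fromMaybe 0ℚ (update c i a j)
        A-at : A i ≡ a
        A-at = cong (fromMaybe 0ℚ) (update-at c i a)
        A-off : ∀ j → j ≢ i → A j ≡ b j
        A-off j j≢i = cong (fromMaybe 0ℚ) (update-off c i a j j≢i)

  own-turn : ∀ {p} k c → Legal c → unfilled (suc d) c ≡ suc (suc k) →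
    (∀ c′ → Legal c′ → unfilled (suc d) c′ ≡ suc k → Wins R d p (other p) c′) → Wins R d p p c
  own-turn k c legal count continue with some-unfilled (suc d) c (suc k) count
  ... | i , cᵢ≡nothing = ownMove i 1ℚ move (continue (update c i 1ℚ) (legal-update c i 1ℚ legal move)
                                                  (ℕ.suc-injective (trans (sym (unfilled-update c i 1ℚ cᵢ≡nothing)) count)))
    where move : LegalMove R d c i 1ℚ
          move = cᵢ≡nothing , D-1 , λ _ ()

  opponent-turn : ∀ {p} k c → Legal c → unfilled (suc d) c ≡ suc (suc k) →
    (∀ c′ → Legal c′ → unfilled (suc d) c′ ≡ suc k → Wins R d p p c′) → Wins R d p (other p) c
  opponent-turn k c legal count continue = oppMove (some-unfilled (suc d) c (suc k) count) λ i a move →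
    continue (update c i a) (legal-update c i a legal move)
             (ℕ.suc-injective (trans (sym (unfilled-update c i a (proj₁ move))) count))

  strategy : ∀ k p m c → Legal c → unfilled (suc d) c ≡ suc k → moverOf k m ≡ p → Wins R d p m c
  strategy zero    p     m     c legal count refl = finish m c legal count
  strategy (suc k) Wanda Wanda c legal count last = own-turn k c legal count λ c′ ok n → strategy k Wanda Nora  c′ ok n last
  strategy (suc k) Nora  Nora  c legal count last = own-turn k c legal count λ c′ ok n → strategy k Nora  Wanda c′ ok n last
  strategy (suc k) Wanda Nora  c legal count last = opponent-turn k c legal count λ c′ ok n → strategy k Wanda Wanda c′ ok n last
  strategy (suc k) Nora  Wanda c legal count last = opponent-turn k c legal count λ c′ ok n → strategy k Nora  Nora  c′ ok n last

-- Initially all d + 1 slots are open, and move number d is the last one.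
theorem4p1 : (R : SubringZQ) (d : ℕ) → d ≥ 2 → (first : Player) →
    Wins R d (moverOf d first) first (emptyPos d)
theorem4p1 R d 2≤d first =
  strategy d (moverOf d first) first (emptyPos d) legal-empty (all-unfilled (suc d)) refl
  where open Game R d 2≤d
        open UnfilledSlots using (all-unfilled)
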